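{- Let $a,b$ be integers with $\gcd(a,b)=1$. A positive integer $n$ satisfies $n\mid a^n-b^n$ if and only if its prime factorization can be written in the form $$n=p_1^{k_1}p_2^{k_2}\cdots p_r^{k_r}\qquad (r\ge 0,\ p_1<p_2<\dots<p_r \text{ primes},\ \text{all } k_i\ge 1),$$ where $p_i\mid a^{n_i}-b^{n_i}$ for $i=1,\dots,r$, with $n_1=1$ and $n_i=p_1^{k_1}p_2^{k_2}\cdots p_{i-1}^{k_{i-1}}$ for $i=2,\dots,r$. (Here the $k_i$ are arbitrary positive integers; $n=1$ corresponds to $r=0$.)
   Context: For integers $a,b$ and $j\ge 1$, $R^{(j)}_{a,b}$ denotes the set of positive integers $n$ such that $n^j$ divides $a^n-b^n$; the theorem describes $R^{(1)}_{a,b}$. -}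

module Defs where

open import Data.Nat as ℕ using (ℕ; _*_; _<_; _≤_)
open import Data.Nat.Primality using (Prime)
open import Data.Integer as ℤ using (ℤ; +_)
open import Data.Integer.Divisibility as ℤD using ()
open import Data.List using (List; []; _∷_)
open import Data.Product using (_×_; _,_)
open import Data.Unit using (⊤)
open import Level using (0ℓ)

-- A candidate factorization: a list of (prime, exponent) pairs (p₁,k₁) ∷ … ∷ (p_r,k_r).
Factorization : Set
Factorization = List (ℕ × ℕ)

value : Factorization → ℕ
value []            = 1
value ((p , k) ∷ f) = (p ℕ.^ k) * value f

-- Conditions of the theorem, walking along the list.
--   m      : the product of the prime powers preceding the current one (n_i)
--   lower  : the previous prime p_{i-1} (0 at the start), so p_{i-1} < p_i
-- At each entry (p , k): p prime, p_{i-1} < p, k ≥ 1, and p ∣ a^{n_i} - b^{n_i} in ℤ.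
AdmissibleFrom : ℤ → ℤ → ℕ → ℕ → Factorization → Set
AdmissibleFrom a b m lower []            = ⊤
AdmissibleFrom a b m lower ((p , k) ∷ f) =
  Prime p × lower < p × 1 ≤ k ×
  ((+ p) ℤD.∣ (a ℤ.^ m ℤ.- b ℤ.^ m)) ×
  AdmissibleFrom a b (m * (p ℕ.^ k)) p f

-- n₁ = 1, and no lower bound on p₁ (0 < p₁ holds for every prime).
Admissible : ℤ → ℤ → Factorization → Set
Admissible a b f = AdmissibleFrom a b 1 0 f

module Submission where

-- If D ∣ x − y and k ∣ x − y then D·k ∣ xᵏ − yᵏ, because
-- xᵏ − yᵏ = (x − y)·(xᵏ⁻¹ + xᵏ⁻²y + ⋯ + yᵏ⁻¹) and the second factor is
-- ≡ k·yᵏ⁻¹ ≡ 0 modulo k.  Walking along an admissible factorisation, each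
-- prime power pᵏ is absorbed by k such lifting steps.
--
-- Conversely let n ∣ aⁿ − bⁿ, let p be the least prime factor of
-- the part r of n not yet factored, and n = m·r.  Then p ∤ a, b, and by
-- pigeonhole on the residues of aⁱ·bᵖ⁻ⁱ (0 ≤ i < p) there is 1 ≤ d < p with
-- p ∣ aᵈ − bᵈ.  Exponents e with p ∣ aᵉ − bᵉ are closed under gcd, so
-- p ∣ a^g − b^g for g = gcd(n, d); as g < p and r has no prime factor below
-- p, g is coprime to r and therefore divides m, whence p ∣ aᵐ − bᵐ.
-- Splitting off the full power of p from r and recursing on the rest builds
-- the admissible factorisation.

open import Defs
open import Data.Nat as ℕ using (ℕ)
open import Data.Integer as ℤ using (ℤ; +_)
open import Data.Integer.Divisibility as ℤD using ()
open import Data.Integer.GCD as ℤG using ()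
open import Data.Product using (_×_; Σ-syntax)
open import Function.Bundles using (_⇔_)
open import Relation.Binary.PropositionalEquality using (_≡_)

open import Data.Nat using (zero; suc; _≤_; _<_; _∸_; NonZero)
import Data.Nat.Properties as ℕP
import Data.Nat.Divisibility as ℕD
import Data.Nat.GCD as ℕG
open import Data.Nat.Coprimality using (Coprime; coprime-divisor)
open import Data.Nat.Primality
open import Data.Nat.Induction using (<-wellFounded)
import Data.Nat.Tactic.RingSolver as ℕSolver
open import Data.Integer using (_+_; _*_; _-_; _^_; ∣_∣)
import Data.Integer.Properties as ℤP
open import Data.Integer.Divisibility.Signed as ℤS using () renaming (_∣_ to _∣ℤ_)
open import Data.Integer.DivMod using (_%ℕ_; _/ℕ_; a≡a%ℕn+[a/ℕn]*n; n%ℕd<d)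
open import Data.Integer.Tactic.RingSolver using (solve-∀)
open import Data.Fin as Fin using (Fin; toℕ; fromℕ<)
open import Data.Fin.Properties using (pigeonhole; toℕ-fromℕ<; toℕ<n)
open import Data.List using ([]; _∷_)
open import Data.Product using (_,_)
open import Data.Sum using (_⊎_; inj₁; inj₂)
open import Data.Unit using (tt)
open import Function using (_∘_)
open import Function.Bundles using (mk⇔)
open import Induction.WellFounded using (Acc; acc)
open import Relation.Nullary using (¬_; yes; no; contradiction)
open import Relation.Binary.PropositionalEquality
  using (refl; sym; trans; cong; cong₂; subst; subst₂; module ≡-Reasoning)

geomSum : ℤ → ℤ → ℕ → ℤ
geomSum x y zero    = + 0
geomSum x y (suc n) = x ^ n + y * geomSum x y n

pow-sub-factor : ∀ x y n → x ^ n - y ^ n ≡ (x - y) * geomSum x y n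
pow-sub-factor x y zero    = sym (ℤP.*-zeroʳ (x - y))
pow-sub-factor x y (suc n) = begin
  x * x ^ n - y * y ^ n                           ≡⟨ regroup x y (x ^ n) (y ^ n) ⟩
  (x - y) * x ^ n + y * (x ^ n - y ^ n)           ≡⟨ cong (λ t → (x - y) * x ^ n + y * t) (pow-sub-factor x y n) ⟩
  (x - y) * x ^ n + y * ((x - y) * geomSum x y n) ≡⟨ collect x y (x ^ n) (geomSum x y n) ⟩
  (x - y) * (x ^ n + y * geomSum x y n)           ∎
  where
  open ≡-Reasoning
  regroup : ∀ x y X Y → x * X - y * Y ≡ (x - y) * X + y * (X - Y)
  regroup = solve-∀
  collect : ∀ x y X g → (x - y) * X + y * ((x - y) * g) ≡ (x - y) * (X + y * g)
  collect = solve-∀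

∣sub⇒∣pow-sub : ∀ {d x y} k → d ∣ℤ x - y → d ∣ℤ x ^ k - y ^ k
∣sub⇒∣pow-sub {d} {x} {y} k d∣x-y =
  subst (d ∣ℤ_) (sym (pow-sub-factor x y k)) (ℤS.∣m⇒∣m*n (geomSum x y k) d∣x-y)

geomSum-cong : ∀ {d x y} n → d ∣ℤ x - y → d ∣ℤ geomSum x y n - geomSum y y n
geomSum-cong zero    _ = ℤS.divides (+ 0) refl
geomSum-cong {d} {x} {y} (suc n) d∣x-y =
  subst (d ∣ℤ_) (sym (regroup (x ^ n) (y ^ n) y (geomSum x y n) (geomSum y y n)))
    (ℤS.∣m∣n⇒∣m+n (∣sub⇒∣pow-sub n d∣x-y) (ℤS.∣n⇒∣m*n y (geomSum-cong n d∣x-y)))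
  where
  regroup : ∀ X Y y A B → (X + y * A) - (Y + y * B) ≡ (X - Y) + y * (A - B)
  regroup = solve-∀

geomSum-diagonal : ∀ y n → geomSum y y (suc n) ≡ + suc n * y ^ n
geomSum-diagonal y zero    = cong (λ t → + 1 + t) (ℤP.*-zeroʳ y)
geomSum-diagonal y (suc n) = begin
  y * y ^ n + y * geomSum y y (suc n)   ≡⟨ cong (λ t → y * y ^ n + y * t) (geomSum-diagonal y n) ⟩
  y * y ^ n + y * (+ suc n * y ^ n)     ≡⟨ collect y (y ^ n) (+ suc n) ⟩
  (+ 1 + + suc n) * (y * y ^ n)         ≡⟨ cong (_* (y * y ^ n)) (sym (ℤP.pos-+ 1 (suc n))) ⟩
  + suc (suc n) * (y * y ^ n)           ∎
  where
  open ≡-Reasoning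
  collect : ∀ y Y N → y * Y + y * (N * Y) ≡ (+ 1 + N) * (y * Y)
  collect = solve-∀

geomSum-divisible : ∀ {x y} k → + k ∣ℤ x - y → + k ∣ℤ geomSum x y k
geomSum-divisible zero    _ = ℤS.divides (+ 0) refl
geomSum-divisible {x} {y} (suc n) k∣x-y =
  subst (+ suc n ∣ℤ_) (sym (split (geomSum x y (suc n)) (geomSum y y (suc n))))
    (ℤS.∣m∣n⇒∣m+n (geomSum-cong (suc n) k∣x-y)
      (subst (+ suc n ∣ℤ_) (sym (geomSum-diagonal y n)) (ℤS.∣m⇒∣m*n (y ^ n) ℤS.∣-refl)))
  where
  split : ∀ A B → A ≡ (A - B) + B
  split = solve-∀

*-pres-∣ℤ : ∀ {d e u v} → d ∣ℤ u → e ∣ℤ v → d * e ∣ℤ u * v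
*-pres-∣ℤ {d} {e} {u} {v} d∣u e∣v = ℤS.∣ᵤ⇒∣
  (subst₂ ℕD._∣_ (sym (ℤP.abs-* d e)) (sym (ℤP.abs-* u v))
    (ℕD.*-pres-∣ (ℤS.∣⇒∣ᵤ d∣u) (ℤS.∣⇒∣ᵤ e∣v)))

lift : ∀ {D x y} k → D ∣ℤ x - y → + k ∣ℤ x - y → D * + k ∣ℤ x ^ k - y ^ k
lift {D} {x} {y} k D∣x-y k∣x-y =
  subst (D * + k ∣ℤ_) (sym (pow-sub-factor x y k)) (*-pres-∣ℤ D∣x-y (geomSum-divisible k k∣x-y))

prime∣*⇒∣ : ∀ {p} x y → Prime p → + p ∣ℤ x * y → + p ∣ℤ x ⊎ + p ∣ℤ y
prime∣*⇒∣ {p} x y p-prime p∣xy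
  with euclidsLemma ∣ x ∣ ∣ y ∣ p-prime (subst (p ℕD.∣_) (ℤP.abs-* x y) (ℤS.∣⇒∣ᵤ p∣xy))
... | inj₁ p∣x = inj₁ (ℤS.∣ᵤ⇒∣ p∣x)
... | inj₂ p∣y = inj₂ (ℤS.∣ᵤ⇒∣ p∣y)

prime∣*∧∤⇒∣ : ∀ {p u w} → Prime p → ¬ (+ p ∣ℤ u) → + p ∣ℤ u * w → + p ∣ℤ w
prime∣*∧∤⇒∣ {u = u} {w} p-prime p∤u p∣uw with prime∣*⇒∣ u w p-prime p∣uw
... | inj₁ p∣u = contradiction p∣u p∤u
... | inj₂ p∣w = p∣w

prime⇒≥2 : ∀ {p} → Prime p → 2 ≤ p
prime⇒≥2 {p} p-prime = ℕ.nonTrivial⇒n>1 p {{prime⇒nonTrivial p-prime}}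

prime∣^⇒∣ : ∀ {p} x n → Prime p → + p ∣ℤ x ^ n → + p ∣ℤ x
prime∣^⇒∣ x zero    p-prime p∣1 =
  contradiction (ℕD.∣1⇒≡1 (ℤS.∣⇒∣ᵤ p∣1)) (ℕ.nonTrivial⇒≢1 {{prime⇒nonTrivial p-prime}})
prime∣^⇒∣ x (suc n) p-prime p∣xxⁿ with prime∣*⇒∣ x (x ^ n) p-prime p∣xxⁿ
... | inj₁ p∣x  = p∣x
... | inj₂ p∣xⁿ = prime∣^⇒∣ x n p-prime p∣xⁿ

coprime⇒¬prime∣both : ∀ {a b p} → ℤG.gcd a b ≡ + 1 → Prime p → + p ∣ℤ a → ¬ (+ p ∣ℤ b)
coprime⇒¬prime∣both {a} {b} {p} a⊥b p-prime p∣a p∣b =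
  ℕ.nonTrivial⇒≢1 {{prime⇒nonTrivial p-prime}} (ℕD.∣1⇒≡1 (subst (p ℕD.∣_) (cong ∣_∣ a⊥b) p∣gcd))
  where
  p∣gcd : p ℕD.∣ ∣ ℤG.gcd a b ∣
  p∣gcd = ℤG.gcd-greatest {a} {b} {+ p} (ℤS.∣⇒∣ᵤ p∣a) (ℤS.∣⇒∣ᵤ p∣b)

∣sub∧∣ʳ⇒∣ˡ : ∀ {d x y} → d ∣ℤ x - y → d ∣ℤ y → d ∣ℤ x
∣sub∧∣ʳ⇒∣ˡ {d} {x} {y} d∣x-y d∣y = subst (d ∣ℤ_) (sym (split x y)) (ℤS.∣m∣n⇒∣m+n d∣x-y d∣y)
  where
  split : ∀ x y → x ≡ (x - y) + y
  split = solve-∀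

∣sub∧∣ˡ⇒∣ʳ : ∀ {d x y} → d ∣ℤ x - y → d ∣ℤ x → d ∣ℤ y
∣sub∧∣ˡ⇒∣ʳ {d} {x} {y} d∣x-y d∣x = subst (d ∣ℤ_) (sym (split x y)) (ℤS.∣m∣n⇒∣m-n d∣x d∣x-y)
  where
  split : ∀ x y → y ≡ x - (x - y)
  split = solve-∀

¬∣⇒residue≢0 : ∀ {P} .{{_ : NonZero P}} x → ¬ (+ P ∣ℤ x) → ¬ (x %ℕ P ≡ 0)
¬∣⇒residue≢0 {P} x P∤x x%P≡0 = P∤x (ℤS.divides (x /ℕ P) (begin
  x                           ≡⟨ a≡a%ℕn+[a/ℕn]*n x P ⟩
  + (x %ℕ P) + (x /ℕ P) * + P ≡⟨ cong (λ t → + t + (x /ℕ P) * + P) x%P≡0 ⟩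
  + 0 + (x /ℕ P) * + P        ≡⟨ ℤP.+-identityˡ _ ⟩
  (x /ℕ P) * + P              ∎))
  where open ≡-Reasoning

equal-residues⇒∣sub : ∀ {P} .{{_ : NonZero P}} x y → x %ℕ P ≡ y %ℕ P → + P ∣ℤ x - y
equal-residues⇒∣sub {P} x y same = ℤS.divides (x /ℕ P - y /ℕ P) (begin
  x - y                             ≡⟨ cong₂ _-_ (a≡a%ℕn+[a/ℕn]*n x P) (a≡a%ℕn+[a/ℕn]*n y P) ⟩
  (+ r + qx * + P) - (+ (y %ℕ P) + qy * + P) ≡⟨ cong (λ t → (+ r + qx * + P) - (+ t + qy * + P)) (sym same) ⟩
  (+ r + qx * + P) - (+ r + qy * + P) ≡⟨ cancel (+ r) qx qy (+ P) ⟩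
  (qx - qy) * + P                   ∎)
  where
  open ≡-Reasoning
  r = x %ℕ P
  qx = x /ℕ P
  qy = y /ℕ P
  cancel : ∀ R A B P → (R + A * P) - (R + B * P) ≡ (A - B) * P
  cancel = solve-∀

-- Pigeonhole: among P integers, none of them divisible by P, two are
-- congruent modulo P, since their residues take only P − 1 values.
residue-collision : ∀ {P} .{{_ : NonZero P}} (v : Fin P → ℤ) → (∀ i → ¬ (+ P ∣ℤ v i)) →
  Σ[ i ∈ Fin P ] Σ[ j ∈ Fin P ] (i Fin.< j × + P ∣ℤ v j - v i)
residue-collision {P} v P∤v =
  let (i , j , i<j , same-slot) = pigeonhole pred[P]<P slot
  in  i , j , i<j , equal-residues⇒∣sub (v j) (v i) (sym (slot-injective i j same-slot))
  where
  residue-nonzero : ∀ i → NonZero (v i %ℕ P)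
  residue-nonzero i = ℕ.≢-nonZero (¬∣⇒residue≢0 (v i) (P∤v i))
  pred[P]<P : ℕ.pred P < P
  pred[P]<P = subst (ℕ.pred P <_) (ℕP.suc-pred P) (ℕP.n<1+n (ℕ.pred P))
  slot-bound : ∀ i → ℕ.pred (v i %ℕ P) < ℕ.pred P
  slot-bound i = ℕP.pred-mono-< {{residue-nonzero i}} (n%ℕd<d (v i) P)
  slot : Fin P → Fin (ℕ.pred P)
  slot i = fromℕ< (slot-bound i)
  slot-injective : ∀ i j → slot i ≡ slot j → v i %ℕ P ≡ v j %ℕ P
  slot-injective i j same = ℕP.pred-injective {{residue-nonzero i}} {{residue-nonzero j}}
    (trans (sym (toℕ-fromℕ< (slot-bound i))) (trans (cong toℕ same) (toℕ-fromℕ< (slot-bound j))))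

rough⇒coprime : ∀ {p r d} → p Rough r → 0 < d → d < p → Coprime d r
rough⇒coprime {d = d} rough d>0 d<p {zero} (0∣d , _) =
  contradiction (ℕD.0∣⇒≡0 0∣d) (ℕ.≢-nonZero⁻¹ d {{ℕ.>-nonZero d>0}})
rough⇒coprime rough d>0 d<p {suc zero} _ = refl
rough⇒coprime rough d>0 d<p {suc (suc c)} (c∣d , c∣r) =
  contradiction (ℕD.hasNonTrivialDivisor c<p c∣r) rough
  where
  c<p : suc (suc c) < _
  c<p = ℕP.≤-<-trans (ℕD.∣⇒≤ {{ℕ.>-nonZero d>0}} c∣d) d<p

-- The least divisor ≥ m of r, found by trying m, m + 1, …, r in turn
-- (k counts the candidates left); it keeps r free of divisors below it.
least-divisor-from : ∀ k {m r} → k ℕ.+ m ≡ r → m Rough r →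
  Σ[ q ∈ ℕ ] (m ≤ q × q Rough r × q ℕD.∣ r)
least-divisor-from zero    {m} refl rough = m , ℕP.≤-refl , rough , ℕD.∣-refl
least-divisor-from (suc k) {m} {r} k+m≡r rough with m ℕD.∣? r
... | yes m∣r = m , ℕP.≤-refl , rough , m∣r
... | no  m∤r =
  let (q , m<q , q-rough , q∣r) =
        least-divisor-from k (trans (ℕP.+-suc k m) k+m≡r) (∤⇒rough-suc m∤r rough)
  in  q , ℕP.<⇒≤ m<q , q-rough , q∣r

least-prime-factor : ∀ {r} → 2 ≤ r → Σ[ p ∈ ℕ ] (Prime p × p Rough r × p ℕD.∣ r)
least-prime-factor r≥2 =
  let (p , p≥2 , p-rough , p∣r) = least-divisor-from _ (ℕP.m∸n+n≡m r≥2) 2-rough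
  in  p , rough∧∣⇒prime {{ℕ.n>1⇒nonTrivial p≥2}} p-rough p∣r , p-rough , p∣r

cofactor-smaller : ∀ {q r s} → 2 ≤ q → 0 < r → r ≡ s ℕ.* q → 0 < s × s < r
cofactor-smaller {s = zero}  q≥2 r>0 refl = contradiction r>0 (λ ())
cofactor-smaller {q} {s = suc s} q≥2 r>0 refl = ℕ.z<s , ℕP.m<m*n (suc s) q q≥2

split-off-power : ∀ {q} → 2 ≤ q → ∀ r → Acc _<_ r → 0 < r → q ℕD.∣ r →
  Σ[ k ∈ ℕ ] Σ[ s ∈ ℕ ] (0 < k × r ≡ q ℕ.^ k ℕ.* s × ¬ (q ℕD.∣ s) × 0 < s × s < r)
split-off-power {q} q≥2 r (acc smaller) r>0 (ℕD.divides s r≡sq)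
  with cofactor-smaller q≥2 r>0 r≡sq | q ℕD.∣? s
... | s>0 , s<r | no q∤s = 1 , s , ℕ.z<s , trans r≡sq (reorder s q) , q∤s , s>0 , s<r
  where
  reorder : ∀ s q → s ℕ.* q ≡ (q ℕ.* 1) ℕ.* s
  reorder = ℕSolver.solve-∀
... | s>0 , s<r | yes q∣s =
  let (k , t , _ , s≡qᵏt , q∤t , t>0 , t<s) = split-off-power q≥2 s (smaller s<r) s>0 q∣s
  in  suc k , t , ℕ.z<s , trans r≡sq (trans (cong (ℕ._* q) s≡qᵏt) (reorder q (q ℕ.^ k) t)) ,
      q∤t , t>0 , ℕP.<-trans t<s s<r
  where
  reorder : ∀ q Q t → (Q ℕ.* t) ℕ.* q ≡ (q ℕ.* Q) ℕ.* t
  reorder = ℕSolver.solve-∀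

module Exponents (a b : ℤ) where

  infix 4 _∣Δ_
  _∣Δ_ : ℤ → ℕ → Set
  d ∣Δ m = d ∣ℤ a ^ m - b ^ m

  SelfDividing : ℕ → Set
  SelfDividing n = + n ∣Δ n

  ∣Δ-multiple : ∀ {d m l} → m ℕD.∣ l → d ∣Δ m → d ∣Δ l
  ∣Δ-multiple {d} {m} (ℕD.divides q refl) d∣Δm =
    subst (d ∣Δ_) (ℕP.*-comm m q)
      (subst₂ (λ s t → d ∣ℤ s - t) (ℤP.^-*-assoc a m q) (ℤP.^-*-assoc b m q)
        (∣sub⇒∣pow-sub q d∣Δm))

  SelfDividing-step : ∀ m k → SelfDividing m → + k ∣Δ m → SelfDividing (m ℕ.* k)
  SelfDividing-step m k m∣Δm k∣Δm =
    subst₂ _∣ℤ_ (sym (ℤP.pos-* m k)) (cong₂ _-_ (ℤP.^-*-assoc a m k) (ℤP.^-*-assoc b m k))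
      (lift k m∣Δm k∣Δm)

  SelfDividing-power : ∀ m p k → SelfDividing m → + p ∣Δ m → SelfDividing (m ℕ.* p ℕ.^ k)
  SelfDividing-power m p zero    m∣Δm _    = subst SelfDividing (sym (ℕP.*-identityʳ m)) m∣Δm
  SelfDividing-power m p (suc k) m∣Δm p∣Δm =
    subst SelfDividing (reassoc m p (p ℕ.^ k))
      (SelfDividing-step (m ℕ.* p ℕ.^ k) p (SelfDividing-power m p k m∣Δm p∣Δm)
        (∣Δ-multiple {m = m} (ℕD.m∣m*n (p ℕ.^ k)) p∣Δm))
    where
    reassoc : ∀ m p P → (m ℕ.* P) ℕ.* p ≡ m ℕ.* (p ℕ.* P)
    reassoc = ℕSolver.solve-∀

  admissible⇒SelfDividing : ∀ m lower f → AdmissibleFrom a b m lower f →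
    SelfDividing m → SelfDividing (m ℕ.* value f)
  admissible⇒SelfDividing m lower []            _ m∣Δm =
    subst SelfDividing (sym (ℕP.*-identityʳ m)) m∣Δm
  admissible⇒SelfDividing m lower ((p , k) ∷ f) (_ , _ , _ , p∣Δm , rest) m∣Δm =
    subst SelfDividing (ℕP.*-assoc m (p ℕ.^ k) (value f))
      (admissible⇒SelfDividing (m ℕ.* p ℕ.^ k) p f rest
        (SelfDividing-power m p k m∣Δm (ℤS.∣ᵤ⇒∣ p∣Δm)))

  prime∣Δ⇒∤a∧∤b : ∀ {p m} → ℤG.gcd a b ≡ + 1 → Prime p → 0 < m → + p ∣Δ m →
    ¬ (+ p ∣ℤ a) × ¬ (+ p ∣ℤ b)
  prime∣Δ⇒∤a∧∤b {p} {suc m} a⊥b p-prime _ p∣Δ = p∤a , p∤b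
    where
    p∤a : ¬ (+ p ∣ℤ a)
    p∤a p∣a = coprime⇒¬prime∣both a⊥b p-prime p∣a
      (prime∣^⇒∣ b (suc m) p-prime (∣sub∧∣ˡ⇒∣ʳ p∣Δ (ℤS.∣m⇒∣m*n (a ^ m) p∣a)))
    p∤b : ¬ (+ p ∣ℤ b)
    p∤b p∣b = coprime⇒¬prime∣both a⊥b p-prime
      (prime∣^⇒∣ a (suc m) p-prime (∣sub∧∣ʳ⇒∣ˡ p∣Δ (ℤS.∣m⇒∣m*n (b ^ m) p∣b))) p∣b

  -- From a^(k+m) − b^(k+m) = aᵐ(aᵏ − bᵏ) + bᵏ(aᵐ − bᵐ): a common divisor
  -- of a^(k+m) − b^(k+m) and aᵐ − bᵐ divides aᵐ(aᵏ − bᵏ).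
  ∣Δ-sum : ∀ {d} k m → d ∣Δ m → d ∣Δ k ℕ.+ m → d ∣ℤ a ^ m * (a ^ k - b ^ k)
  ∣Δ-sum {d} k m d∣Δm d∣Δk+m =
    subst (d ∣ℤ_)
      (trans (cong (λ t → t - b ^ k * (a ^ m - b ^ m))
               (cong₂ _-_ (ℤP.^-distribˡ-+-* a k m) (ℤP.^-distribˡ-+-* b k m)))
             (expand (a ^ k) (b ^ k) (a ^ m) (b ^ m)))
      (ℤS.∣m∣n⇒∣m-n d∣Δk+m (ℤS.∣n⇒∣m*n (b ^ k) d∣Δm))
    where
    expand : ∀ A B C D → A * C - B * D - B * (C - D) ≡ C * (A - B)
    expand = solve-∀

  module CoprimePrime {p} (p-prime : Prime p) (p∤a : ¬ (+ p ∣ℤ a)) (p∤b : ¬ (+ p ∣ℤ b)) where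

    private instance
      p≢0 : NonZero p
      p≢0 = prime⇒nonZero p-prime

    ∤power-product : ∀ i j → ¬ (+ p ∣ℤ a ^ i * b ^ j)
    ∤power-product i j p∣aⁱbʲ with prime∣*⇒∣ (a ^ i) (b ^ j) p-prime p∣aⁱbʲ
    ... | inj₁ p∣aⁱ = p∤a (prime∣^⇒∣ a i p-prime p∣aⁱ)
    ... | inj₂ p∣bʲ = p∤b (prime∣^⇒∣ b j p-prime p∣bʲ)

    ∣Δ-difference : ∀ k m {l} → k ℕ.+ m ≡ l → + p ∣Δ m → + p ∣Δ l → + p ∣Δ k
    ∣Δ-difference k m refl p∣Δm p∣Δk+m =
      prime∣*∧∤⇒∣ p-prime (p∤a ∘ prime∣^⇒∣ a m p-prime) (∣Δ-sum k m p∣Δm p∣Δk+m)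

    ∣Δ-gcd : ∀ u v → + p ∣Δ u → + p ∣Δ v → + p ∣Δ ℕG.gcd u v
    ∣Δ-gcd u v p∣Δu p∣Δv with ℕG.Bézout.identity (ℕG.gcd-GCD u v)
    ... | ℕG.Bézout.+- x y g+yv≡xu =
      ∣Δ-difference (ℕG.gcd u v) (y ℕ.* v) g+yv≡xu
        (∣Δ-multiple {m = v} (ℕD.n∣m*n y) p∣Δv) (∣Δ-multiple {m = u} (ℕD.n∣m*n x) p∣Δu)
    ... | ℕG.Bézout.-+ x y g+xu≡yv =
      ∣Δ-difference (ℕG.gcd u v) (x ℕ.* u) g+xu≡yv
        (∣Δ-multiple {m = u} (ℕD.n∣m*n x) p∣Δu) (∣Δ-multiple {m = v} (ℕD.n∣m*n y) p∣Δv)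

    ∣Δ-from-collision : ∀ {i j} → i ≤ j → j ≤ p →
      + p ∣ℤ a ^ j * b ^ (p ∸ j) - a ^ i * b ^ (p ∸ i) → + p ∣Δ j ∸ i
    ∣Δ-from-collision {i} {j} i≤j j≤p p∣diff =
      prime∣*∧∤⇒∣ p-prime (∤power-product i e) (subst (+ p ∣ℤ_) factor p∣diff)
      where
      d = j ∸ i
      e = p ∸ j
      p∸i≡d+e : p ∸ i ≡ d ℕ.+ e
      p∸i≡d+e = begin
        p ∸ i             ≡⟨ cong (_∸ i) (sym (ℕP.m∸n+n≡m j≤p)) ⟩
        (e ℕ.+ j) ∸ i     ≡⟨ ℕP.+-∸-assoc e i≤j ⟩
        e ℕ.+ d           ≡⟨ ℕP.+-comm e d ⟩
        d ℕ.+ e           ∎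
        where open ≡-Reasoning
      regroup : ∀ A C D E → A * C * E - A * (D * E) ≡ A * E * (C - D)
      regroup = solve-∀
      factor : a ^ j * b ^ e - a ^ i * b ^ (p ∸ i) ≡ (a ^ i * b ^ e) * (a ^ d - b ^ d)
      factor = begin
        a ^ j * b ^ e - a ^ i * b ^ (p ∸ i)
          ≡⟨ cong₂ (λ s t → a ^ s * b ^ e - a ^ i * b ^ t) (sym (ℕP.m+[n∸m]≡n i≤j)) p∸i≡d+e ⟩
        a ^ (i ℕ.+ d) * b ^ e - a ^ i * b ^ (d ℕ.+ e)
          ≡⟨ cong₂ (λ s t → s * b ^ e - a ^ i * t) (ℤP.^-distribˡ-+-* a i d) (ℤP.^-distribˡ-+-* b d e) ⟩
        a ^ i * a ^ d * b ^ e - a ^ i * (b ^ d * b ^ e)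
          ≡⟨ regroup (a ^ i) (a ^ d) (b ^ d) (b ^ e) ⟩
        a ^ i * b ^ e * (a ^ d - b ^ d) ∎
        where open ≡-Reasoning

    -- Some exponent 0 < d < p has p ∣Δ d (a weak form of Fermat's little
    -- theorem): the p numbers aⁱb^(p−i), 0 ≤ i < p, are prime to p, so two of
    -- them are congruent modulo p.
    ∣Δ-below : Σ[ d ∈ ℕ ] (0 < d × d < p × + p ∣Δ d)
    ∣Δ-below =
      let (i , j , i<j , p∣diff) = residue-collision power-product
                                     (λ i → ∤power-product (toℕ i) (p ∸ toℕ i))
      in  toℕ j ∸ toℕ i , ℕP.m<n⇒0<n∸m i<j , ℕP.≤-<-trans (ℕP.m∸n≤m (toℕ j) (toℕ i)) (toℕ<n j) ,
          ∣Δ-from-collision (ℕP.<⇒≤ i<j) (ℕP.<⇒≤ (toℕ<n j)) p∣diff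
      where
      power-product : Fin p → ℤ
      power-product i = a ^ toℕ i * b ^ (p ∸ toℕ i)

    -- Indeed g = gcd(m·r, d) has
    -- p ∣Δ g, and g ∣ d < p makes g coprime to r, so g ∣ m.
    ∣Δ-cofactor : ∀ {d} m r → 0 < d → d < p → + p ∣Δ d → p Rough r → + p ∣Δ m ℕ.* r → + p ∣Δ m
    ∣Δ-cofactor {d} m r d>0 d<p p∣Δd rough p∣Δmr =
      ∣Δ-multiple g∣m (∣Δ-gcd (m ℕ.* r) d p∣Δmr p∣Δd)
      where
      g : ℕ
      g = ℕG.gcd (m ℕ.* r) d
      g⊥r : Coprime g r
      g⊥r (c∣g , c∣r) = rough⇒coprime rough d>0 d<p (ℕD.∣-trans c∣g (ℕG.gcd[m,n]∣n (m ℕ.* r) d) , c∣r)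
      g∣m : g ℕD.∣ m
      g∣m = coprime-divisor g⊥r (subst (g ℕD.∣_) (ℕP.*-comm m r) (ℕG.gcd[m,n]∣m (m ℕ.* r) d))

    ∣Δ-rough-cofactor : ∀ m r → p Rough r → + p ∣Δ m ℕ.* r → + p ∣Δ m
    ∣Δ-rough-cofactor m r = descend ∣Δ-below
      where
      descend : Σ[ d ∈ ℕ ] (0 < d × d < p × + p ∣Δ d) → p Rough r → + p ∣Δ m ℕ.* r → + p ∣Δ m
      descend (d , d>0 , d<p , p∣Δd) = ∣Δ-cofactor m r d>0 d<p p∣Δd

module Construction (a b : ℤ) (a⊥b : ℤG.gcd a b ≡ + 1) (n : ℕ) (n>0 : 0 < n)
                    (n∣Δn : Exponents.SelfDividing a b n) where
  open Exponents a b

  -- Invariant: n = m·r where m is the product of the prime powers found so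
  -- far, the largest of which is `lower`, and r has no prime factor ≤ lower.
  -- The least prime p of r divides aᵐ − bᵐ by ∣Δ-rough-cofactor; we split off
  -- its full power pᵏ and continue with m·pᵏ and the cofactor.
  factorise : ∀ m lower r → Acc _<_ r → 0 < r → suc lower Rough r → n ≡ m ℕ.* r →
    Σ[ f ∈ Factorization ] (value f ≡ r × AdmissibleFrom a b m lower f)
  factorise m lower r (acc smaller) r>0 rough n≡mr with r ℕ.≟ 1
  ... | yes refl = [] , refl , tt
  ... | no  r≢1  with least-prime-factor (ℕP.≤∧≢⇒< r>0 (r≢1 ∘ sym))
  ... | p , p-prime , p-rough , p∣r with split-off-power (prime⇒≥2 p-prime) r (acc smaller) r>0 p∣r
  ... | k , s , k>0 , r≡pᵏs , p∤s , s>0 , s<r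
    with factorise (m ℕ.* p ℕ.^ k) p s (smaller s<r) s>0
           (∤⇒rough-suc p∤s (rough∧∣⇒rough p-rough (ℕD.divides (p ℕ.^ k) r≡pᵏs)))
           (trans n≡mr (trans (cong (m ℕ.*_) r≡pᵏs) (sym (ℕP.*-assoc m (p ℕ.^ k) s))))
  ... | f , value-f , admissible-f =
    (p , k) ∷ f , trans (cong (p ℕ.^ k ℕ.*_) value-f) (sym r≡pᵏs) ,
    p-prime , lower<p , k>0 , ℤS.∣⇒∣ᵤ p∣Δm , admissible-f
    where
    lower<p : lower < p
    lower<p = rough⇒≤ {{prime⇒nonTrivial p-prime}} (rough∧∣⇒rough rough p∣r)
    p∣Δn : + p ∣Δ n
    p∣Δn = ℤS.∣-trans (ℤS.∣ᵤ⇒∣ (ℕD.∣-trans p∣r (ℕD.divides m n≡mr))) n∣Δn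
    p∣Δm : + p ∣Δ m
    p∣Δm = let (p∤a , p∤b) = prime∣Δ⇒∤a∧∤b a⊥b p-prime n>0 p∣Δn
           in  CoprimePrime.∣Δ-rough-cofactor p-prime p∤a p∤b m r p-rough
                 (subst (+ p ∣Δ_) n≡mr p∣Δn)

theorem1 : (a b : ℤ) → ℤG.gcd a b ≡ + 1 → (n : ℕ) → 1 ℕ.≤ n →
    ((+ n) ℤD.∣ (a ℤ.^ n ℤ.- b ℤ.^ n)) ⇔
    (Σ[ f ∈ Factorization ] (value f ≡ n × Admissible a b f))
theorem1 a b a⊥b n n>0 = mk⇔ necessary sufficient
  where
  open Exponents a b using (SelfDividing; admissible⇒SelfDividing)
  necessary : + n ℤD.∣ a ^ n - b ^ n → Σ[ f ∈ Factorization ] (value f ≡ n × Admissible a b f)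
  necessary n∣ = Construction.factorise a b a⊥b n n>0 (ℤS.∣ᵤ⇒∣ n∣)
    1 0 n (<-wellFounded n) n>0 1-rough (sym (ℕP.*-identityˡ n))
  sufficient : Σ[ f ∈ Factorization ] (value f ≡ n × Admissible a b f) → + n ℤD.∣ a ^ n - b ^ n
  sufficient (f , value-f , admissible-f) = ℤS.∣⇒∣ᵤ
    (subst SelfDividing (trans (ℕP.*-identityˡ (value f)) value-f)
      (admissible⇒SelfDividing 1 0 f admissible-f (ℤS.∣ᵤ⇒∣ (ℕD.1∣ _))))
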